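{- Let $\Pi_q$ be a projective plane of order $q$ with point set $\mathcal{P}$ and line set $\mathcal{L}$. Let $P$ be a point, let $\mathcal{L}_P$ be the set of lines through $P$, and let $\ell',\ell''\in\mathcal{L}\setminus\mathcal{L}_P$ be two (not necessarily distinct) lines. Define $f^*:\mathcal{L}\to 2^{\mathbb{N}}$ by $f^*(\ell)=\{1,2,\ldots,q\}$ for $\ell\in\mathcal{L}_P$; for $\ell\notin\mathcal{L}_P$, let $f^*(\ell)$ consist of $0$ if $\ell=\ell'$ and of $q+1$ if $\ell=\ell''$ (so $f^*(\ell')=\{0\}$, $f^*(\ell'')=\{q+1\}$ if $\ell'\neq\ell''$, $f^*(\ell')=\{0,q+1\}$ if $\ell'=\ell''$, and $f^*(\ell)=\emptyset$ for all other lines). Then there is no set $S\subseteq\mathcal{P}$ such that $|S\cap\ell|\notin f^*(\ell)$ for every $\ell\in\mathcal{L}$.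
   Context: A projective plane of order $q$ has $q^2+q+1$ points and $q^2+q+1$ lines, each line has $q+1$ points, each point lies on $q+1$ lines, two points lie on a unique line and two lines meet in a unique point. Lines are identified with their point sets. -}

module Defs where

open import Data.Nat using (ℕ; suc; _+_; _*_; _≤_)
open import Data.Fin using (Fin)
open import Data.Fin.Subset using (Subset; _∈_; ∣_∣; _∩_)
open import Data.Fin.Subset.Properties using (_∈?_)
open import Data.Vec using (tabulate)
open import Data.Product using (Σ; _×_)
open import Data.Sum using (_⊎_)
open import Relation.Nullary using (¬_; does)
open import Relation.Binary.PropositionalEquality using (_≡_)

size : ℕ → ℕ
size q = q * q + q + 1

record ProjectivePlane (q : ℕ) : Set where
  field
    line : Fin (size q) → Subset (size q)
  linesThrough : Fin (size q) → Subset (size q)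
  linesThrough p = tabulate (λ l → does (p ∈? line l))
  field
    line-size  : ∀ l → ∣ line l ∣ ≡ suc q
    point-deg  : ∀ p → ∣ linesThrough p ∣ ≡ suc q
    two-points : ∀ p r → ¬ p ≡ r →
                 Σ (Fin (size q)) λ l → (p ∈ line l × r ∈ line l) ×
                   (∀ m → p ∈ line m → r ∈ line m → m ≡ l)
    two-lines  : ∀ l m → ¬ l ≡ m →
                 Σ (Fin (size q)) λ p → (p ∈ line l × p ∈ line m) ×
                   (∀ r → r ∈ line l → r ∈ line m → r ≡ p)

fStar : ∀ {q} → ProjectivePlane q → (P ℓ' ℓ'' ℓ : Fin (size q)) → ℕ → Set
fStar {q} Π P ℓ' ℓ'' ℓ k =
  (P ∈ ProjectivePlane.line Π ℓ × (1 ≤ k × k ≤ q)) ⊎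
  (¬ P ∈ ProjectivePlane.line Π ℓ × ((ℓ ≡ ℓ' × k ≡ 0) ⊎ (ℓ ≡ ℓ'' × k ≡ suc q)))

{-# OPTIONS --safe #-}
-- A line through P must meet S in 0 or q + 1 points, so it lies inside S or is
-- disjoint from it, according to whether P ∈ S. Every other point is joined to P
-- by a line, so S contains all points or none, except possibly P itself. As P is
-- on neither ℓ' nor ℓ'', either ℓ'' meets S in q + 1 points or ℓ' meets S in none.
module Submission where

open import Defs
open import Data.Nat using (ℕ; suc; _≤_; _<_; s≤s; z≤n)
open import Data.Nat.Properties using (≤-antisym; ≤-trans; ≤-pred)
open import Data.Fin using (Fin)
open import Data.Fin.Subset using (Subset; _∈_; _∉_; ∣_∣; _∩_; _⊆_; Empty)
open import Data.Fin.Subset.Properties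
  using (_∈?_; x∈p⇒∣p-x∣<∣p∣; p⊂q⇒∣p∣<∣q∣; p⊆q⇒∣p∣≤∣q∣; p∩q⊆q; ∣p∩q∣≤∣q∣;
         x∈p∩q⁺; x∈p∩q⁻; Empty-unique; ∣⊥∣≡0)
open import Data.Product using (Σ; _,_; _×_; proj₁)
open import Data.Sum using (inj₁; inj₂)
open import Relation.Nullary using (¬_; yes; no; contradiction)
open import Relation.Binary.PropositionalEquality
  using (_≡_; _≢_; refl; subst; trans; cong)

private
  variable
    n : ℕ
    x : Fin n
    p L S : Subset n

x∈p⇒∣p∣≥1 : x ∈ p → 1 ≤ ∣ p ∣
x∈p⇒∣p∣≥1 x∈p = ≤-trans (s≤s z≤n) (x∈p⇒∣p-x∣<∣p∣ x∈p)

x∈L∖S⇒∣S∩L∣<∣L∣ : x ∈ L → x ∉ S → ∣ S ∩ L ∣ < ∣ L ∣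
x∈L∖S⇒∣S∩L∣<∣L∣ {L = L} {S = S} x∈L x∉S =
  p⊂q⇒∣p∣<∣q∣ (p∩q⊆q S L , _ , x∈L , λ x∈S∩L → x∉S (proj₁ (x∈p∩q⁻ S L x∈S∩L)))

L⊆S⇒∣S∩L∣≡∣L∣ : L ⊆ S → ∣ S ∩ L ∣ ≡ ∣ L ∣
L⊆S⇒∣S∩L∣≡∣L∣ {L = L} {S = S} L⊆S =
  ≤-antisym (∣p∩q∣≤∣q∣ S L) (p⊆q⇒∣p∣≤∣q∣ λ x∈L → x∈p∩q⁺ (L⊆S x∈L , x∈L))

Empty⇒∣p∣≡0 : {p : Subset n} → Empty p → ∣ p ∣ ≡ 0
Empty⇒∣p∣≡0 {n = n} p-empty = trans (cong ∣_∣ (Empty-unique p-empty)) (∣⊥∣≡0 n)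

inside-or-disjoint : ∀ {n k} {L S : Subset n} {x y : Fin n} →
                     ∣ L ∣ ≡ suc k → ¬ (1 ≤ ∣ S ∩ L ∣ × ∣ S ∩ L ∣ ≤ k) →
                     x ∈ L → y ∈ L → x ∈ S → y ∈ S
inside-or-disjoint {k = k} {L} {S} {y = y} ∣L∣≡1+k not-partial x∈L y∈L x∈S with y ∈? S
... | yes y∈S = y∈S
... | no  y∉S = contradiction (∣S∩L∣≥1 , ∣S∩L∣≤k) not-partial
  where
    ∣S∩L∣≥1 : 1 ≤ ∣ S ∩ L ∣
    ∣S∩L∣≥1 = x∈p⇒∣p∣≥1 (x∈p∩q⁺ (x∈S , x∈L))

    ∣S∩L∣≤k : ∣ S ∩ L ∣ ≤ k
    ∣S∩L∣≤k = ≤-pred (subst (∣ S ∩ L ∣ <_) ∣L∣≡1+k (x∈L∖S⇒∣S∩L∣<∣L∣ y∈L y∉S))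

module Admissible {q : ℕ} (Π : ProjectivePlane q) (P ℓ' ℓ'' : Fin (size q))
                  (S : Subset (size q))
                  (admissible : ∀ ℓ → ¬ fStar Π P ℓ' ℓ'' ℓ ∣ S ∩ ProjectivePlane.line Π ℓ ∣)
                  where
  open ProjectivePlane Π

  line-through-P-inside-or-disjoint : ∀ {m x y} → P ∈ line m → x ∈ line m → y ∈ line m →
                                      x ∈ S → y ∈ S
  line-through-P-inside-or-disjoint {m} P∈m =
    inside-or-disjoint (line-size m) λ partial → admissible m (inj₁ (P∈m , partial))

  P∈S⇒r∈S : ∀ {r} → P ≢ r → P ∈ S → r ∈ S
  P∈S⇒r∈S {r} P≢r with two-points P r P≢r
  ... | m , (P∈m , r∈m) , _ = line-through-P-inside-or-disjoint P∈m P∈m r∈m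

  r∈S⇒P∈S : ∀ {r} → P ≢ r → r ∈ S → P ∈ S
  r∈S⇒P∈S {r} P≢r with two-points P r P≢r
  ... | m , (P∈m , r∈m) , _ = line-through-P-inside-or-disjoint P∈m r∈m P∈m

  P∉line⇒P≢ : ∀ {ℓ r} → P ∉ line ℓ → r ∈ line ℓ → P ≢ r
  P∉line⇒P≢ P∉ℓ r∈ℓ refl = P∉ℓ r∈ℓ

  P∈S⇒∣S∩line∣≡1+q : ∀ {ℓ} → P ∉ line ℓ → P ∈ S → ∣ S ∩ line ℓ ∣ ≡ suc q
  P∈S⇒∣S∩line∣≡1+q {ℓ} P∉ℓ P∈S =
    trans (L⊆S⇒∣S∩L∣≡∣L∣ λ r∈ℓ → P∈S⇒r∈S (P∉line⇒P≢ P∉ℓ r∈ℓ) P∈S) (line-size ℓ)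

  P∉S⇒∣S∩line∣≡0 : ∀ {ℓ} → P ∉ line ℓ → P ∉ S → ∣ S ∩ line ℓ ∣ ≡ 0
  P∉S⇒∣S∩line∣≡0 {ℓ} P∉ℓ P∉S = Empty⇒∣p∣≡0 λ (r , r∈S∩ℓ) →
    let r∈S , r∈ℓ = x∈p∩q⁻ S (line ℓ) r∈S∩ℓ
    in P∉S (r∈S⇒P∈S (P∉line⇒P≢ P∉ℓ r∈ℓ) r∈S)

mainTheorem4 : (q : ℕ) (Π : ProjectivePlane q) (P ℓ' ℓ'' : Fin (size q)) →
    ¬ P ∈ ProjectivePlane.line Π ℓ' → ¬ P ∈ ProjectivePlane.line Π ℓ'' →
    ¬ Σ (Subset (size q)) λ S →
    ∀ ℓ → ¬ fStar Π P ℓ' ℓ'' ℓ ∣ S ∩ ProjectivePlane.line Π ℓ ∣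
mainTheorem4 q Π P ℓ' ℓ'' P∉ℓ' P∉ℓ'' (S , admissible) with P ∈? S
... | yes P∈S = admissible ℓ'' (inj₂ (P∉ℓ'' , inj₂ (refl , P∈S⇒∣S∩line∣≡1+q P∉ℓ'' P∈S)))
  where open Admissible Π P ℓ' ℓ'' S admissible
... | no  P∉S = admissible ℓ'  (inj₂ (P∉ℓ'  , inj₁ (refl , P∉S⇒∣S∩line∣≡0 P∉ℓ' P∉S)))
  where open Admissible Π P ℓ' ℓ'' S admissible
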